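{- Let $N$ be a positive integer and $M>1$ an integer. Let $X$ be a word set which is an $(N+M-1)$-block presentation, let $Y$ be its maximal $(N+M-1)$-preimage and $Z$ its maximal $N$-preimage. If $Z$ is an $M$-block presentation, then $Y$ is the maximal $M$-preimage of $Z$.
   Context: Words over a finite alphabet may be finite, infinite or bi-infinite; a word set is any set of such words. A projection is a map between alphabets extended letter by letter to words; $X\succcurlyeq Y$ means $\varphi(X)=Y$ for some projection $\varphi$; $X\sim Y$ (similar) means $X\succcurlyeq Y$ and $Y\succcurlyeq X$. For $K\ge1$, the $K$-block presentation $W^{[K]}$ of a word set $W$ (all of whose words have length at least $K$) replaces each word $u$ by the word whose $i$-th letter is the block $[u_iu_{i+1}\dots u_{i+K-1}]$. A word set $V$ is a $K$-block presentation if $V\sim W^{[K]}$ for some word set $W$; such $W$ is a $K$-preimage of $V$. The maximal $K$-preimage of a $K$-block presentation $V$ is a $K$-preimage $U$ of $V$ such that $U\succcurlyeq W$ for every $K$-preimage $W$ of $V$; it exists and is unique up to similarity. (An $(N+M-1)$-block presentation is in particular an $N$-block presentation, since $(W^{[M]})^{[N]}\sim W^{[N+M-1]}$.) -}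

module Defs where

open import Level using (Level)
open import Data.Nat using (ℕ; _+_; _≤_)
open import Data.Integer as ℤ using (ℤ)
open import Data.Fin using (Fin; toℕ)
open import Data.List as List using (List; []; _∷_; length)
open import Data.Vec as Vec using (Vec; tabulate)
open import Data.Maybe using (Maybe; just; nothing)
open import Data.Product using (Σ; ∃; _×_; _,_)
open import Data.Unit using (⊤)
open import Data.Empty using (⊥)
open import Function.Bundles using (_↔_)
open import Relation.Binary.PropositionalEquality using (_≡_)

record Alphabet : Set₁ where
  field
    Carrier : Set
    size    : ℕ
    enum    : Carrier ↔ Fin size
open Alphabet public

data Word (A : Set) : Set where
  fin : List A → Word A
  inf : (ℕ → A) → Word A
  bi  : (ℤ → A) → Word A

_≋_ : {A : Set} → Word A → Word A → Set
fin u ≋ fin v = u ≡ v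
inf u ≋ inf v = ∀ i → u i ≡ v i
bi u  ≋ bi v  = ∀ i → u i ≡ v i
_ ≋ _ = ⊥

mapWord : {A B : Set} → (A → B) → Word A → Word B
mapWord φ (fin u) = fin (List.map φ u)
mapWord φ (inf u) = inf (λ i → φ (u i))
mapWord φ (bi u)  = bi (λ i → φ (u i))

WordSet : Set → Set₁
WordSet A = Word A → Set

ImageIs : {A B : Set} → (A → B) → WordSet A → WordSet B → Set
ImageIs φ X Y =
  (∀ x → X x → ∃ λ y → Y y × (mapWord φ x ≋ y)) ×
  (∀ y → Y y → ∃ λ x → X x × (mapWord φ x ≋ y))

_≽_ : {A B : Set} → WordSet A → WordSet B → Set
_≽_ {A} {B} X Y = Σ (A → B) λ φ → ImageIs φ X Y

_∼_ : {A B : Set} → WordSet A → WordSet B → Set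
X ∼ Y = (X ≽ Y) × (Y ≽ X)

takeVec : {A : Set} (K : ℕ) → List A → Maybe (Vec A K)
takeVec ℕ.zero xs = just Vec.[]
takeVec (ℕ.suc K) [] = nothing
takeVec (ℕ.suc K) (x ∷ xs) with takeVec K xs
... | just v  = just (x Vec.∷ v)
... | nothing = nothing

blocksL : {A : Set} (K : ℕ) → List A → List (Vec A K)
blocksL K [] = []
blocksL K (x ∷ xs) with takeVec K (x ∷ xs)
... | just v  = v ∷ blocksL K xs
... | nothing = []

blockWord : {A : Set} (K : ℕ) → Word A → Word (Vec A K)
blockWord K (fin u) = fin (blocksL K u)
blockWord K (inf u) = inf (λ i → tabulate (λ j → u (i + toℕ j)))
blockWord K (bi u)  = bi (λ i → tabulate (λ j → u (i ℤ.+ ℤ.+ toℕ j)))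

LengthAtLeast : {A : Set} → ℕ → Word A → Set
LengthAtLeast K (fin u) = K ≤ length u
LengthAtLeast K (inf _) = ⊤
LengthAtLeast K (bi _)  = ⊤

BlockPres : {A : Set} (K : ℕ) → WordSet A → WordSet (Vec A K)
BlockPres K W v = ∃ λ w → W w × (blockWord K w ≡ v)

IsPreimage : {A B : Set} → ℕ → WordSet A → WordSet B → Set
IsPreimage K V W = (∀ w → W w → LengthAtLeast K w) × (V ∼ BlockPres K W)

IsBlockPresentation : {A : Set} → ℕ → WordSet A → Set₁
IsBlockPresentation K V =
  Σ Alphabet λ B → Σ (WordSet (Carrier B)) λ W → IsPreimage K V W

IsMaxPreimage : {A B : Set} → ℕ → WordSet A → WordSet B → Set₁
IsMaxPreimage K V U =
  IsPreimage K V U ×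
  ((C : Alphabet) (W : WordSet (Carrier C)) → IsPreimage K V W → U ≽ W)

module Submission where

-- Blocks of blocks are blocks: cutting an (N+M-1)-block into its N consecutive M-sub-blocks is a
-- projection of W^[N+M-1] onto (W^[M])^[N], and gluing the sub-blocks back is one in the other
-- direction, so (W^[M])^[N] ∼ W^[N+M-1].  Hence every M-preimage V of Z is an (N+M-1)-preimage of X,
-- as X ∼ Z^[N] ∼ (V^[M])^[N] ∼ V^[N+M-1], and so Y ≽ V.  It remains that Y is an M-preimage of Z:
-- Y^[M] is an N-preimage of X, so Z ≽ Y^[M] by maximality of Z, while for some M-preimage W of Z
-- we have Y ≽ W and therefore Y^[M] ≽ W^[M] ≽ Z.

open import Defs
open import Level using (0ℓ)
open import Data.Nat using (ℕ; zero; suc; _+_; _∸_; _≤_; _<_; _^_; z≤n; s≤s; s≤s⁻¹; z<s; NonZero; >-nonZero)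
open import Data.Nat.Properties
import Data.Integer as ℤ
import Data.Integer.Properties as ℤ
open import Data.Fin using (Fin; toℕ; fromℕ; fromℕ<; inject₁; splitAt; _↑ˡ_; _↑ʳ_)
open import Data.Fin.Properties using (toℕ<n; toℕ-fromℕ; toℕ-fromℕ<; toℕ-inject₁; toℕ-↑ˡ; toℕ-↑ʳ; toℕ-injective; splitAt⁻¹-↑ˡ; splitAt⁻¹-↑ʳ; *↔×)
open import Data.List as List using (List; []; _∷_; length)
import Data.List.Properties as List
open import Data.Vec as Vec using (Vec; []; _∷_; tabulate; lookup)
open import Data.Vec.Properties using (lookup∘tabulate; tabulate∘lookup; tabulate-cong; tabulate-∘; lookup-map)
open import Data.Vec.Effectful using (module TraversableA)
open import Data.Maybe as Maybe using (Maybe; just; nothing)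
import Data.Maybe.Effectful as Maybe
open import Data.Product using (∃; _×_; _,_; proj₁; proj₂; uncurry)
open import Data.Product.Function.NonDependent.Propositional using (_×-↔_)
open import Data.Sum using (inj₁; inj₂)
open import Data.Unit using (tt)
open import Function using (_∘_)
open import Function.Bundles using (_↔_; mk↔ₛ′)
open import Function.Properties.Inverse using (↔-trans; ↔-sym)
open import Relation.Binary.PropositionalEquality

open TraversableA (Maybe.applicative {0ℓ}) using (sequenceA)

vecAlphabet : Alphabet → ℕ → Alphabet
vecAlphabet A k = record { Carrier = Vec (Carrier A) k ; size = size A ^ k ; enum = Vec↔Fin^ k }
  where
  Vec↔Fin^ : ∀ k → Vec (Carrier A) k ↔ Fin (size A ^ k)
  Vec↔Fin^ zero    = mk↔ₛ′ (λ _ → Fin.zero) (λ _ → []) (λ { Fin.zero → refl ; (Fin.suc ()) })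
                             (λ { [] → refl })
  Vec↔Fin^ (suc k) = ↔-trans ∷↔× (↔-trans (enum A ×-↔ Vec↔Fin^ k) (↔-sym *↔×))
    where
    ∷↔× : Vec (Carrier A) (suc k) ↔ (Carrier A × Vec (Carrier A) k)
    ∷↔× = mk↔ₛ′ (λ { (x ∷ v) → x , v }) (uncurry Vec._∷_) (λ _ → refl) (λ { (x ∷ v) → refl })

module _ {A : Set} where

  ≋-sym : {x y : Word A} → x ≋ y → y ≋ x
  ≋-sym {fin _} {fin _} p = sym p
  ≋-sym {inf _} {inf _} p = sym ∘ p
  ≋-sym {bi _}  {bi _}  p = sym ∘ p

  ≋-trans : {x y z : Word A} → x ≋ y → y ≋ z → x ≋ z
  ≋-trans {fin _} {fin _} {fin _} p q = trans p q
  ≋-trans {inf _} {inf _} {inf _} p q = λ i → trans (p i) (q i)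
  ≋-trans {bi _}  {bi _}  {bi _}  p q = λ i → trans (p i) (q i)

  LengthAtLeast-≋ : ∀ {K} {x y : Word A} → LengthAtLeast K x → x ≋ y → LengthAtLeast K y
  LengthAtLeast-≋ {x = fin _} {fin _} p refl = p
  LengthAtLeast-≋ {x = inf _} {inf _} _ _ = tt
  LengthAtLeast-≋ {x = bi _}  {bi _}  _ _ = tt

  LengthAtLeast-≤ : ∀ {K L} → L ≤ K → (x : Word A) → LengthAtLeast K x → LengthAtLeast L x
  LengthAtLeast-≤ L≤K (fin _) p = ≤-trans L≤K p
  LengthAtLeast-≤ L≤K (inf _) _ = tt
  LengthAtLeast-≤ L≤K (bi _)  _ = tt

module _ {A B : Set} (φ : A → B) where

  mapWord-≋ : {x y : Word A} → x ≋ y → mapWord φ x ≋ mapWord φ y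
  mapWord-≋ {fin _} {fin _} p = cong (List.map φ) p
  mapWord-≋ {inf _} {inf _} p = cong φ ∘ p
  mapWord-≋ {bi _}  {bi _}  p = cong φ ∘ p

  LengthAtLeast-mapWord : ∀ {K} (x : Word A) → LengthAtLeast K x → LengthAtLeast K (mapWord φ x)
  LengthAtLeast-mapWord {K} (fin u) p = subst (K ≤_) (sym (List.length-map φ u)) p
  LengthAtLeast-mapWord (inf _) _ = tt
  LengthAtLeast-mapWord (bi _)  _ = tt

mapWord-∘ : {A B C : Set} (ψ : B → C) (φ : A → B) (x : Word A) →
            mapWord (ψ ∘ φ) x ≋ mapWord ψ (mapWord φ x)
mapWord-∘ ψ φ (fin u) = List.map-∘ u
mapWord-∘ ψ φ (inf _) = λ _ → refl
mapWord-∘ ψ φ (bi _)  = λ _ → refl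

mapWord-inverseˡ : {A B : Set} {ψ : B → A} {φ : A → B} → (∀ a → ψ (φ a) ≡ a) →
                   (x : Word A) → mapWord ψ (mapWord φ x) ≋ x
mapWord-inverseˡ ψφ (fin u) = trans (sym (List.map-∘ u)) (trans (List.map-cong ψφ u) (List.map-id u))
mapWord-inverseˡ ψφ (inf u) = ψφ ∘ u
mapWord-inverseˡ ψφ (bi u)  = ψφ ∘ u

≽-trans : {A B C : Set} {X : WordSet A} {Y : WordSet B} {Z : WordSet C} →
          X ≽ Y → Y ≽ Z → X ≽ Z
≽-trans {X = X} {Z = Z} (φ , φ-into , φ-onto) (ψ , ψ-into , ψ-onto) = ψ ∘ φ , into , onto
  where
  into : ∀ x → X x → ∃ λ z → Z z × (mapWord (ψ ∘ φ) x ≋ z)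
  into x Xx =
    let y , Yy , φx≋y = φ-into x Xx
        z , Zz , ψy≋z = ψ-into y Yy
    in z , Zz , ≋-trans (mapWord-∘ ψ φ x) (≋-trans (mapWord-≋ ψ φx≋y) ψy≋z)
  onto : ∀ z → Z z → ∃ λ x → X x × (mapWord (ψ ∘ φ) x ≋ z)
  onto z Zz =
    let y , Yy , ψy≋z = ψ-onto z Zz
        x , Xx , φx≋y = φ-onto y Yy
    in x , Xx , ≋-trans (mapWord-∘ ψ φ x) (≋-trans (mapWord-≋ ψ φx≋y) ψy≋z)

∼-sym : {A B : Set} {X : WordSet A} {Y : WordSet B} → X ∼ Y → Y ∼ X
∼-sym (X≽Y , Y≽X) = Y≽X , X≽Y

∼-trans : {A B C : Set} {X : WordSet A} {Y : WordSet B} {Z : WordSet C} →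
          X ∼ Y → Y ∼ Z → X ∼ Z
∼-trans (X≽Y , Y≽X) (Y≽Z , Z≽Y) = ≽-trans X≽Y Y≽Z , ≽-trans Z≽Y Y≽X

≽-LengthAtLeast : ∀ {A B K} {X : WordSet A} {Y : WordSet B} → X ≽ Y →
                  (∀ x → X x → LengthAtLeast K x) → ∀ y → Y y → LengthAtLeast K y
≽-LengthAtLeast (φ , _ , onto) lenX y Yy =
  let x , Xx , φx≋y = onto y Yy in
  LengthAtLeast-≋ (LengthAtLeast-mapWord φ x (lenX x Xx)) φx≋y

module _ {A : Set} where

  sequence-just⁺ : ∀ {K} (v : Vec (Maybe A) K) (w : Vec A K) →
                   (∀ k → lookup v k ≡ just (lookup w k)) → sequenceA v ≡ just w
  sequence-just⁺ [] [] _ = refl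
  sequence-just⁺ (x ∷ v) (a ∷ w) vk≡wk
    rewrite vk≡wk Fin.zero | sequence-just⁺ v w (vk≡wk ∘ Fin.suc) = refl

  sequence-just⁻ : ∀ {K} (v : Vec (Maybe A) K) {w : Vec A K} →
                   sequenceA v ≡ just w → ∀ k → lookup v k ≡ just (lookup w k)
  sequence-just⁻ (just a ∷ v) seq≡w k with sequenceA v in seqv≡
  sequence-just⁻ (just a ∷ v) refl Fin.zero    | just _ = refl
  sequence-just⁻ (just a ∷ v) refl (Fin.suc k) | just _ = sequence-just⁻ v seqv≡ k

  sequence-nothing⁺ : ∀ {K} (v : Vec (Maybe A) K) (k : Fin K) →
                      lookup v k ≡ nothing → sequenceA v ≡ nothing
  sequence-nothing⁺ (_ ∷ _) Fin.zero refl = refl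
  sequence-nothing⁺ (nothing ∷ v) (Fin.suc k) _ = refl
  sequence-nothing⁺ (just _ ∷ v) (Fin.suc k) vk≡nothing rewrite sequence-nothing⁺ v k vk≡nothing = refl

  sequence-nothing⁻ : ∀ {K} (v : Vec (Maybe A) K) →
                      sequenceA v ≡ nothing → ∃ λ k → lookup v k ≡ nothing
  sequence-nothing⁻ (nothing ∷ _) _ = Fin.zero , refl
  sequence-nothing⁻ (just _ ∷ v) seq≡nothing with sequenceA v in seqv≡
  ... | nothing = let k , vk≡nothing = sequence-nothing⁻ v seqv≡ in Fin.suc k , vk≡nothing

sequence-map : ∀ {A B : Set} {K} (f : A → B) (v : Vec (Maybe A) K) →
               sequenceA (Vec.map (Maybe.map f) v) ≡ Maybe.map (Vec.map f) (sequenceA v)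
sequence-map f [] = refl
sequence-map f (nothing ∷ v) = refl
sequence-map f (just a ∷ v) rewrite sequence-map f v with sequenceA v
... | just _  = refl
... | nothing = refl

module _ {A : Set} where

  at : List A → ℕ → Maybe A
  at []       _       = nothing
  at (x ∷ _)  zero    = just x
  at (_ ∷ xs) (suc i) = at xs i

  at-extensional : (u v : List A) → (∀ i → at u i ≡ at v i) → u ≡ v
  at-extensional []       []       _    = refl
  at-extensional []       (_ ∷ _)  u≗v with () ← u≗v 0
  at-extensional (_ ∷ _)  []       u≗v with () ← u≗v 0
  at-extensional (x ∷ xs) (y ∷ ys) u≗v with refl ← u≗v 0 =
    cong (x ∷_) (at-extensional xs ys (u≗v ∘ suc))

  at-≥length : (u : List A) {i : ℕ} → length u ≤ i → at u i ≡ nothing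
  at-≥length []       _            = refl
  at-≥length (_ ∷ xs) (s≤s |xs|≤i) = at-≥length xs |xs|≤i

  window : ∀ K → List A → ℕ → Vec (Maybe A) K
  window K u i = tabulate λ j → at u (i + toℕ j)

  takeVec-sequence : ∀ K (u : List A) → takeVec K u ≡ sequenceA (window K u 0)
  takeVec-sequence zero    _        = refl
  takeVec-sequence (suc K) []       = refl
  takeVec-sequence (suc K) (x ∷ xs) with takeVec K xs | takeVec-sequence K xs
  ... | just _  | t≡seq = cong (Maybe.map (x ∷_)) t≡seq
  ... | nothing | t≡seq = cong (Maybe.map (x ∷_)) t≡seq

at-map : ∀ {A B : Set} (f : A → B) (u : List A) i → at (List.map f u) i ≡ Maybe.map f (at u i)
at-map f []       _       = refl
at-map f (x ∷ _)  zero    = refl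
at-map f (_ ∷ xs) (suc i) = at-map f xs i

module _ {A : Set} where

  takeVec-just⇒≤ : ∀ K (u : List A) {v : Vec A K} → takeVec K u ≡ just v → K ≤ length u
  takeVec-just⇒≤ zero    _        _ = z≤n
  takeVec-just⇒≤ (suc K) (x ∷ xs) _ with takeVec K xs in take≡
  ... | just _ = s≤s (takeVec-just⇒≤ K xs take≡)

  takeVec-nothing⇒> : ∀ K (u : List A) → takeVec K u ≡ nothing → length u < K
  takeVec-nothing⇒> (suc K) []       _ = s≤s z≤n
  takeVec-nothing⇒> (suc K) (x ∷ xs) _ with takeVec K xs in take≡
  ... | nothing = s≤s (takeVec-nothing⇒> K xs take≡)

  -- A finite word u is handled through its partial letter function `at u`: its blocks are the
  -- windows all of whose letters exist.  (K = 0 is excluded: then every window exists,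
  -- but blocksL 0 u has only length u blocks.)
  at-blocksL : ∀ K .⦃ _ : NonZero K ⦄ (u : List A) i → at (blocksL K u) i ≡ sequenceA (window K u i)
  at-blocksL (suc K) []       i = refl
  at-blocksL (suc K) (x ∷ xs) i with takeVec (suc K) (x ∷ xs) in take≡
  at-blocksL (suc K) (x ∷ xs) zero    | just _ = trans (sym take≡) (takeVec-sequence (suc K) (x ∷ xs))
  at-blocksL (suc K) (x ∷ xs) (suc i) | just _ = at-blocksL (suc K) xs i
  ... | nothing =
    sym (sequence-nothing⁺ (window (suc K) (x ∷ xs) i) (fromℕ K)
      (trans (lookup∘tabulate (λ j → at (x ∷ xs) (i + toℕ j)) (fromℕ K))
             (at-≥length (x ∷ xs) |u|≤i+K)))
    where
    |u|≤i+K : length (x ∷ xs) ≤ i + toℕ (fromℕ K)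
    |u|≤i+K = subst (λ k → length (x ∷ xs) ≤ i + k) (sym (toℕ-fromℕ K))
                (≤-trans (s≤s⁻¹ (takeVec-nothing⇒> (suc K) (x ∷ xs) take≡)) (m≤n+m K i))

  length-blocksL : ∀ m (u : List A) → length (blocksL (suc m) u) ≡ length u ∸ m
  length-blocksL m []       = sym (0∸n≡0 m)
  length-blocksL m (x ∷ xs) with takeVec (suc m) (x ∷ xs) in take≡
  ... | just _  = trans (cong suc (length-blocksL m xs))
                        (sym (+-∸-assoc 1 (s≤s⁻¹ (takeVec-just⇒≤ (suc m) (x ∷ xs) take≡))))
  ... | nothing = sym (m≤n⇒m∸n≡0 (s≤s⁻¹ (takeVec-nothing⇒> (suc m) (x ∷ xs) take≡)))

  LengthAtLeast-blockWord⁺ : ∀ n m (w : Word A) → LengthAtLeast (n + suc m) w →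
                             LengthAtLeast (suc n) (blockWord (suc m) w)
  LengthAtLeast-blockWord⁺ n m (fin u) n+1+m≤|u| =
    subst (suc n ≤_) (sym (length-blocksL m u))
          (m+n≤o⇒m≤o∸n (suc n) (subst (_≤ length u) (+-suc n m) n+1+m≤|u|))
  LengthAtLeast-blockWord⁺ n m (inf _) _ = tt
  LengthAtLeast-blockWord⁺ n m (bi _)  _ = tt

  LengthAtLeast-blockWord⁻ : ∀ n m (w : Word A) → LengthAtLeast (suc n) (blockWord (suc m) w) →
                             LengthAtLeast (n + suc m) w
  LengthAtLeast-blockWord⁻ n m (fin u) 1+n≤|blocks| =
    subst (_≤ length u) (sym (+-suc n m))
          (m≤o∸n⇒m+n≤o (suc n) (<⇒≤ (m∸n≢0⇒n<m (m<n⇒n≢0 1+n≤|u|∸m))) 1+n≤|u|∸m)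
    where
    1+n≤|u|∸m : suc n ≤ length u ∸ m
    1+n≤|u|∸m = subst (suc n ≤_) (length-blocksL m u) 1+n≤|blocks|
  LengthAtLeast-blockWord⁻ n m (inf _) _ = tt
  LengthAtLeast-blockWord⁻ n m (bi _)  _ = tt

blocksL-map : ∀ {A B : Set} K .⦃ _ : NonZero K ⦄ (φ : A → B) (u : List A) →
              blocksL K (List.map φ u) ≡ List.map (Vec.map φ) (blocksL K u)
blocksL-map K φ u = at-extensional _ _ λ i → begin
  at (blocksL K (List.map φ u)) i                 ≡⟨ at-blocksL K (List.map φ u) i ⟩
  sequenceA (window K (List.map φ u) i)
    ≡⟨ cong sequenceA (tabulate-cong λ j → at-map φ u (i + toℕ j)) ⟩
  sequenceA (tabulate λ j → Maybe.map φ (at u (i + toℕ j)))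
    ≡⟨ cong sequenceA (tabulate-∘ (Maybe.map φ) (λ j → at u (i + toℕ j))) ⟩
  sequenceA (Vec.map (Maybe.map φ) (window K u i)) ≡⟨ sequence-map φ (window K u i) ⟩
  Maybe.map (Vec.map φ) (sequenceA (window K u i)) ≡⟨ cong (Maybe.map (Vec.map φ)) (at-blocksL K u i) ⟨
  Maybe.map (Vec.map φ) (at (blocksL K u) i)      ≡⟨ at-map (Vec.map φ) (blocksL K u) i ⟨
  at (List.map (Vec.map φ) (blocksL K u)) i       ∎
  where open ≡-Reasoning

blockWord-mapWord : ∀ {A B : Set} K .⦃ _ : NonZero K ⦄ (φ : A → B) (x : Word A) →
                    mapWord (Vec.map φ) (blockWord K x) ≋ blockWord K (mapWord φ x)
blockWord-mapWord K φ (fin u) = sym (blocksL-map K φ u)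
blockWord-mapWord K φ (inf _) = λ _ → sym (tabulate-∘ φ _)
blockWord-mapWord K φ (bi _)  = λ _ → sym (tabulate-∘ φ _)

blockWord-≋ : ∀ {A : Set} K {x y : Word A} → x ≋ y → blockWord K x ≋ blockWord K y
blockWord-≋ K {fin _} {fin _} u≡v = cong (blocksL K) u≡v
blockWord-≋ K {inf _} {inf _} u≗v = λ i → tabulate-cong λ j → u≗v (i + toℕ j)
blockWord-≋ K {bi _}  {bi _}  u≗v = λ i → tabulate-cong λ j → u≗v (i ℤ.+ ℤ.+ toℕ j)

BlockPres-≽ : ∀ {A B : Set} K .⦃ _ : NonZero K ⦄ {X : WordSet A} {Y : WordSet B} →
              X ≽ Y → BlockPres K X ≽ BlockPres K Y
BlockPres-≽ K {X} {Y} (φ , into , onto) = Vec.map φ , blockInto , blockOnto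
  where
  blockInto : ∀ x → BlockPres K X x → ∃ λ y → BlockPres K Y y × (mapWord (Vec.map φ) x ≋ y)
  blockInto _ (x , Xx , refl) =
    let y , Yy , φx≋y = into x Xx
    in blockWord K y , (y , Yy , refl) , ≋-trans (blockWord-mapWord K φ x) (blockWord-≋ K φx≋y)
  blockOnto : ∀ y → BlockPres K Y y → ∃ λ x → BlockPres K X x × (mapWord (Vec.map φ) x ≋ y)
  blockOnto _ (y , Yy , refl) =
    let x , Xx , φx≋y = onto y Yy
    in blockWord K x , (x , Xx , refl) , ≋-trans (blockWord-mapWord K φ x) (blockWord-≋ K φx≋y)

BlockPres-∼ : ∀ {A B : Set} K .⦃ _ : NonZero K ⦄ {X : WordSet A} {Y : WordSet B} →
              X ∼ Y → BlockPres K X ∼ BlockPres K Y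
BlockPres-∼ K (X≽Y , Y≽X) = BlockPres-≽ K X≽Y , BlockPres-≽ K Y≽X

module _ (n m : ℕ) where

  offset : Fin (suc n) → Fin (suc m) → Fin (n + suc m)
  offset a b = fromℕ< (+-mono-≤-< (s≤s⁻¹ (toℕ<n a)) (toℕ<n b))

  split : Fin (n + suc m) → Fin (suc n) × Fin (suc m)
  split k with splitAt n k
  ... | inj₁ a = inject₁ a , Fin.zero
  ... | inj₂ b = fromℕ n , b

  offset-split : ∀ k → uncurry offset (split k) ≡ k
  offset-split k = toℕ-injective (trans (toℕ-fromℕ< _) (sum≡k k))
    where
    sum≡k : ∀ k → toℕ (proj₁ (split k)) + toℕ (proj₂ (split k)) ≡ toℕ k
    sum≡k k with splitAt n k in splitAt≡
    ... | inj₁ a = begin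
      toℕ (inject₁ a) + 0 ≡⟨ +-identityʳ _ ⟩
      toℕ (inject₁ a)     ≡⟨ toℕ-inject₁ a ⟩
      toℕ a               ≡⟨ toℕ-↑ˡ a (suc m) ⟨
      toℕ (a ↑ˡ suc m)    ≡⟨ cong toℕ (splitAt⁻¹-↑ˡ splitAt≡) ⟩
      toℕ k               ∎
      where open ≡-Reasoning
    ... | inj₂ b = begin
      toℕ (fromℕ n) + toℕ b ≡⟨ cong (_+ toℕ b) (toℕ-fromℕ n) ⟩
      n + toℕ b             ≡⟨ toℕ-↑ʳ n b ⟨
      toℕ (n ↑ʳ b)          ≡⟨ cong toℕ (splitAt⁻¹-↑ʳ splitAt≡) ⟩
      toℕ k                 ∎
      where open ≡-Reasoning

  subblocks : {A : Set} → Vec A (n + suc m) → Vec (Vec A (suc m)) (suc n)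
  subblocks v = tabulate λ a → tabulate λ b → lookup v (offset a b)

  glue : {A : Set} → Vec (Vec A (suc m)) (suc n) → Vec A (n + suc m)
  glue w = tabulate λ k → let a , b = split k in lookup (lookup w a) b

  lookup-subblocks : {A : Set} (v : Vec A (n + suc m)) (a : Fin (suc n)) (b : Fin (suc m)) →
                     lookup (lookup (subblocks v) a) b ≡ lookup v (offset a b)
  lookup-subblocks v a b = begin
    lookup (lookup (subblocks v) a) b
      ≡⟨ cong (λ block → lookup block b) (lookup∘tabulate (λ a → tabulate λ b → lookup v (offset a b)) a) ⟩
    lookup (tabulate λ b → lookup v (offset a b)) b
      ≡⟨ lookup∘tabulate (λ b → lookup v (offset a b)) b ⟩
    lookup v (offset a b)
      ∎
    where open ≡-Reasoning

  glue-subblocks : {A : Set} (v : Vec A (n + suc m)) → glue (subblocks v) ≡ v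
  glue-subblocks v = begin
    glue (subblocks v)                                   ≡⟨ tabulate-cong (uncurry (lookup-subblocks v) ∘ split) ⟩
    tabulate (λ k → lookup v (uncurry offset (split k))) ≡⟨ tabulate-cong (cong (lookup v) ∘ offset-split) ⟩
    tabulate (lookup v)                                  ≡⟨ tabulate∘lookup v ⟩
    v                                                    ∎
    where open ≡-Reasoning

  subblocks-window : {I A : Set} (_⊕_ : I → ℕ → I) → (∀ i a b → i ⊕ (a + b) ≡ (i ⊕ a) ⊕ b) →
                     (f : I → A) (i : I) →
                     subblocks (tabulate λ k → f (i ⊕ toℕ k)) ≡
                     tabulate λ a → tabulate λ b → f ((i ⊕ toℕ a) ⊕ toℕ b)
  subblocks-window _⊕_ ⊕-assoc f i = tabulate-cong λ a → tabulate-cong λ b → begin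
    lookup (tabulate λ k → f (i ⊕ toℕ k)) (offset a b) ≡⟨ lookup∘tabulate _ (offset a b) ⟩
    f (i ⊕ toℕ (offset a b))                           ≡⟨ cong (λ k → f (i ⊕ k)) (toℕ-fromℕ< _) ⟩
    f (i ⊕ (toℕ a + toℕ b))                            ≡⟨ cong f (⊕-assoc i (toℕ a) (toℕ b)) ⟩
    f ((i ⊕ toℕ a) ⊕ toℕ b)                            ∎
    where open ≡-Reasoning

  -- subblocks repeats letters but drops none (offset-split), so a window is defined iff all its
  -- sub-blocks are.
  sequence-subblocks : {A : Set} (v : Vec (Maybe A) (n + suc m)) →
                       Maybe.map subblocks (sequenceA v) ≡ sequenceA (Vec.map sequenceA (subblocks v))
  sequence-subblocks v with sequenceA v in seq≡
  ... | just w =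
    sym (sequence-just⁺ (Vec.map sequenceA (subblocks v)) (subblocks w) λ a →
      trans (lookup-map a sequenceA (subblocks v))
            (sequence-just⁺ (lookup (subblocks v) a) (lookup (subblocks w) a) (letter≡just a)))
    where
    letter≡just : ∀ a b → lookup (lookup (subblocks v) a) b ≡ just (lookup (lookup (subblocks w) a) b)
    letter≡just a b = begin
      lookup (lookup (subblocks v) a) b        ≡⟨ lookup-subblocks v a b ⟩
      lookup v (offset a b)                    ≡⟨ sequence-just⁻ v seq≡ (offset a b) ⟩
      just (lookup w (offset a b))             ≡⟨ cong just (lookup-subblocks w a b) ⟨
      just (lookup (lookup (subblocks w) a) b) ∎
      where open ≡-Reasoning
  ... | nothing =
    let k , vk≡nothing = sequence-nothing⁻ v seq≡
        a , b = split k
        letter≡nothing = trans (lookup-subblocks v a b) (trans (cong (lookup v) (offset-split k)) vk≡nothing)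
    in sym (sequence-nothing⁺ (Vec.map sequenceA (subblocks v)) a
             (trans (lookup-map a sequenceA (subblocks v))
                    (sequence-nothing⁺ (lookup (subblocks v) a) b letter≡nothing)))

  private
    instance
      n+1+m-nonZero : NonZero (n + suc m)
      n+1+m-nonZero = >-nonZero (<-≤-trans z<s (m≤n+m (suc m) n))

    +-assoc⁻ : ∀ i a b → i + (a + b) ≡ i + a + b
    +-assoc⁻ i a b = sym (+-assoc i a b)

  blocksL-subblocks : {A : Set} (u : List A) →
                      List.map subblocks (blocksL (n + suc m) u) ≡ blocksL (suc n) (blocksL (suc m) u)
  blocksL-subblocks u = at-extensional _ _ λ i → begin
    at (List.map subblocks (blocksL (n + suc m) u)) i
      ≡⟨ at-map subblocks (blocksL (n + suc m) u) i ⟩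
    Maybe.map subblocks (at (blocksL (n + suc m) u) i)
      ≡⟨ cong (Maybe.map subblocks) (at-blocksL (n + suc m) u i) ⟩
    Maybe.map subblocks (sequenceA (window (n + suc m) u i))
      ≡⟨ sequence-subblocks (window (n + suc m) u i) ⟩
    sequenceA (Vec.map sequenceA (subblocks (window (n + suc m) u i)))
      ≡⟨ cong (sequenceA ∘ Vec.map sequenceA) (subblocks-window _+_ +-assoc⁻ (at u) i) ⟩
    sequenceA (Vec.map sequenceA (tabulate λ a → window (suc m) u (i + toℕ a)))
      ≡⟨ cong sequenceA (tabulate-∘ sequenceA λ a → window (suc m) u (i + toℕ a)) ⟨
    sequenceA (tabulate λ a → sequenceA (window (suc m) u (i + toℕ a)))
      ≡⟨ cong sequenceA (tabulate-cong λ a → at-blocksL (suc m) u (i + toℕ a)) ⟨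
    sequenceA (window (suc n) (blocksL (suc m) u) i)
      ≡⟨ at-blocksL (suc n) (blocksL (suc m) u) i ⟨
    at (blocksL (suc n) (blocksL (suc m) u)) i
      ∎
    where open ≡-Reasoning

  blockWord-subblocks : {A : Set} (w : Word A) →
                        mapWord subblocks (blockWord (n + suc m) w) ≋ blockWord (suc n) (blockWord (suc m) w)
  blockWord-subblocks (fin u) = blocksL-subblocks u
  blockWord-subblocks (inf u) = subblocks-window _+_ +-assoc⁻ u
  blockWord-subblocks (bi u)  = subblocks-window (λ i a → i ℤ.+ ℤ.+ a) (λ i a b → sym (ℤ.+-assoc i _ _)) u

  blockWord-glue : {A : Set} (w : Word A) →
                   mapWord glue (blockWord (suc n) (blockWord (suc m) w)) ≋ blockWord (n + suc m) w
  blockWord-glue w = ≋-trans (mapWord-≋ glue (≋-sym (blockWord-subblocks w)))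
                             (mapWord-inverseˡ glue-subblocks (blockWord (n + suc m) w))

  BlockPres-∘ : {A : Set} (W : WordSet A) → BlockPres (suc n) (BlockPres (suc m) W) ∼ BlockPres (n + suc m) W
  BlockPres-∘ W =
    ( glue
    , (λ { _ (_ , (w , Ww , refl) , refl) → _ , (w , Ww , refl) , blockWord-glue w })
    , (λ { _ (w , Ww , refl) → _ , (_ , (w , Ww , refl) , refl) , blockWord-glue w }))
    ,
    ( subblocks
    , (λ { _ (w , Ww , refl) → _ , (_ , (w , Ww , refl) , refl) , blockWord-subblocks w })
    , (λ { _ (_ , (w , Ww , refl) , refl) → _ , (w , Ww , refl) , blockWord-subblocks w }))

IsPreimage-blockPres : ∀ n m {A B : Set} {X : WordSet A} {Y : WordSet B} →
                       IsPreimage (n + suc m) X Y → IsPreimage (suc n) X (BlockPres (suc m) Y)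
IsPreimage-blockPres n m {Y = Y} (lenY , X∼Y) = lenY^M , ∼-trans X∼Y (∼-sym (BlockPres-∘ n m Y))
  where
  lenY^M : ∀ v → BlockPres (suc m) Y v → LengthAtLeast (suc n) v
  lenY^M _ (y , Yy , refl) = LengthAtLeast-blockWord⁺ n m y (lenY y Yy)

IsPreimage-∘ : ∀ n m {A B C : Set} {X : WordSet A} {Z : WordSet B} {V : WordSet C} →
               IsPreimage (suc n) X Z → IsPreimage (suc m) Z V → IsPreimage (n + suc m) X V
IsPreimage-∘ n m {V = V} (lenZ , X∼Z) (_ , Z∼V^M) =
  lenV , ∼-trans X∼Z (∼-trans (BlockPres-∼ (suc n) Z∼V^M) (BlockPres-∘ n m V))
  where
  lenV : ∀ v → V v → LengthAtLeast (n + suc m) v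
  lenV v Vv = LengthAtLeast-blockWord⁻ n m v (≽-LengthAtLeast (proj₁ Z∼V^M) lenZ _ (v , Vv , refl))

proposition2 : (N M : ℕ) → 1 ≤ N → 1 < M →
    (A B C : Alphabet) →
    (X : WordSet (Carrier A)) (Y : WordSet (Carrier B)) (Z : WordSet (Carrier C)) →
    IsBlockPresentation (N + M ∸ 1) X →
    IsMaxPreimage (N + M ∸ 1) X Y →
    IsMaxPreimage N X Z →
    IsBlockPresentation M Z →
    IsMaxPreimage M Z Y
proposition2 (suc n) (suc m) _ _ _ B _ X Y Z _ (Y-pre , Y-max) (Z-pre , Z-max) (D , W , W-pre) =
  (lenY , Z∼Y^M) , Y-dominates
  where
  Y-dominates : (E : Alphabet) (V : WordSet (Carrier E)) → IsPreimage (suc m) Z V → Y ≽ V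
  Y-dominates E V V-pre = Y-max E V (IsPreimage-∘ n m Z-pre V-pre)

  lenY : ∀ y → Y y → LengthAtLeast (suc m) y
  lenY y Yy = LengthAtLeast-≤ (m≤n+m (suc m) n) y (proj₁ Y-pre y Yy)

  Z∼Y^M : Z ∼ BlockPres (suc m) Y
  Z∼Y^M = Z-max (vecAlphabet B (suc m)) (BlockPres (suc m) Y) (IsPreimage-blockPres n m Y-pre)
        , ≽-trans (BlockPres-≽ (suc m) (Y-dominates D W W-pre)) (proj₂ (proj₂ W-pre))
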